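{- Let $a,b\in\mathcal A$ with $a\neq b$. Then: (1) $[(a\sqcap b)\to a]=\{M\in\mathbb M^0\mid M\rhd_\beta^*\lambda y^0.y^0\}$. (2) It is not the case that $\lambda y^0.y^0:\langle()\vdash_1(a\sqcap b)\to a\rangle$. (3) $\lambda y^0.y^0:\langle()\vdash_2(a\sqcap b)\to a\rangle$.
   Context: Terms ($\lambda I^{\mathbb N}$-calculus). Fix a denumerably infinite set $\mathcal V$ of variable names, partitioned as $\mathcal V=\mathcal V_1\cup\mathcal V_2$ with $\mathcal V_1,\mathcal V_2$ disjoint and denumerably infinite. Indexed variables are $x^n$ with $x\in\mathcal V$, $n\in\mathbb N$. The set $\mathcal M$ of terms, the set $\mathbb M\subseteq\mathcal M$ of good terms, free variables $FV$ and degree $d$ are defined simultaneously: $x^n\in\mathcal M\cap\mathbb M$, $FV(x^n)=\{x^n\}$, $d(x^n)=n$; if $M,N\in\mathcal M$ are joinable ($M\diamond N$: for all $x$, $x^m\in FV(M)$ and $x^n\in FV(N)$ imply $m=n$) then $MN\in\mathcal M$, $FV(MN)=FV(M)\cup FV(N)$, $d(MN)=\min(d(M),d(N))$, and $MN\in\mathbb M$ if moreover $M,N\in\mathbb M$ and $d(M)\le d(N)$; if $M\in\mathcal M$ and $x^n\in FV(M)$ then $\lambda x^n.M\in\mathcal M$, $FV(\lambda x^n.M)=FV(M)\setminus\{x^n\}$, $d(\lambda x^n.M)=d(M)$, and $\lambda x^n.M\in\mathbb M$ if $M\in\mathbb M$. $\mathbb M^n$ is the set of good terms of degree $n$, $\mathcal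 M^0$ the set of terms of degree $0$. Terms are taken modulo $\alpha$-conversion; substitution is defined only when all involved terms are pairwise joinable. $\rhd_\beta$ is the least compatible relation containing $(\lambda x^n.M)N\rhd_\beta M[x^n:=N]$ when $d(N)=n$; $\rhd_\beta^*$ is its reflexive-transitive closure. $M^+$ replaces every variable index $n$ in $M$ by $n+1$; $\mathcal X^+=\{M^+\mid M\in\mathcal X\}$. Types. Fix denumerably infinite sets $\mathcal A$ and $\mathcal E$. $\mathcal T::=a\mid\mathcal T\to\mathcal T\mid\mathcal T\sqcap\mathcal T\mid e\,\mathcal T$; $\mathbb U::=\mathbb U\sqcap\mathbb U\mid e\,\mathbb U\mid\mathbb T$, $\mathbb T::=a\mid\mathbb U\to\mathbb T$ ($a\in\mathcal A$, $e\in\mathcal E$). Types are quotiented by commutativity, associativity, idempotence of $\sqcap$ and $e(U_1\sqcap U_2)=eU_1\sqcap eU_2$. Degree: $d(a)=0$, $d(U\to T)=\min(d(U),d(T))$, $d(eU)=d(U)+1$, $d(U\sqcap V)=\min(d(U),d(V))$. Good types: atoms; $eU$ if $U$ good; $U\to T$ if $U,T$ good and $d(U)\ge d(T)$; $U\sqcap V$ if $U,V$ good and $d(U)=d(V)$. Environments: finite sets $(x_i^{n_i}:U_i)_i$ with distinct $x_i^{n_i}$; $()$ is the empty one; $\Gamma,x^m:U$ adds a declaration for $x^m\notin dom(\Gamma)$; $\Gamma_1\sqcap\Gamma_2$ intersects types of common variables and keeps the rest; $e\Gamma=(x_i^{n_i+1}:eU_i)_i$; $\Gamma_1\diamond\Gamma_2$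 iff any $x^m\in dom(\Gamma_1)$, $x^n\in dom(\Gamma_2)$ have $m=n$. Typing rules of $\vdash_1$ (over $\mathcal T$): (ax) $x^n:\langle(x^n:T)\vdash_1 T\rangle$ if $T$ good and $d(T)=n$; ($\to_I$) from $M:\langle\Gamma,x^n:U\vdash_1 T\rangle$ infer $\lambda x^n.M:\langle\Gamma\vdash_1 U\to T\rangle$; ($\to_E$) from $M_1:\langle\Gamma_1\vdash_1 U\to T\rangle$, $M_2:\langle\Gamma_2\vdash_1 U\rangle$, $\Gamma_1\diamond\Gamma_2$ infer $M_1M_2:\langle\Gamma_1\sqcap\Gamma_2\vdash_1T\rangle$; ($\sqcap$) from $M:\langle\Gamma_1\vdash_1U_1\rangle$, $M:\langle\Gamma_2\vdash_1U_2\rangle$ infer $M:\langle\Gamma_1\sqcap\Gamma_2\vdash_1U_1\sqcap U_2\rangle$; (exp) from $M:\langle\Gamma\vdash_1U\rangle$ infer $M^+:\langle e\Gamma\vdash_1 eU\rangle$. Typing rules of $\vdash_2$ ($U$ over $\mathbb U$, $T$ over $\mathbb T$): the same ($\to_I$), ($\to_E$), ($\sqcap$), (exp) with $\vdash_2$; axiom $x^0:\langle(x^0:T)\vdash_2T\rangle$ if $T$ good; and ($\sqsubseteq$): from $M:\langle\Gamma\vdash_2U\rangle$ and $\langle\Gamma\vdash_2U\rangle\sqsubseteq\langle\Gamma'\vdash_2U'\rangle$ infer $M:\langle\Gamma'\vdash_2U'\rangle$, where $\sqsubseteq$ is the least relation (on $\mathbb U$, environments, typings) closed under reflexivity, transitivity,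 $U_1\sqcap U_2\sqsubseteq U_1$ (if $U_2$ good and $d(U_1)=d(U_2)$), $U_1\sqcap U_2\sqsubseteq V_1\sqcap V_2$ (if $U_i\sqsubseteq V_i$), $U_1\to T_1\sqsubseteq U_2\to T_2$ (if $U_2\sqsubseteq U_1$, $T_1\sqsubseteq T_2$), $eU_1\sqsubseteq eU_2$ (if $U_1\sqsubseteq U_2$), $\Gamma,(y^n:U_1)\sqsubseteq\Gamma,(y^n:U_2)$ (if $U_1\sqsubseteq U_2$), $\langle\Gamma_1\vdash_2U_1\rangle\sqsubseteq\langle\Gamma_2\vdash_2U_2\rangle$ (if $U_1\sqsubseteq U_2$, $\Gamma_2\sqsubseteq\Gamma_1$). Semantics. $\mathcal X\subseteq\mathcal M$ is saturated iff $M\rhd_\beta^*N$, $N\in\mathcal X$ imply $M\in\mathcal X$. $\mathcal X\leadsto\mathcal Y=\{M\in\mathcal M\mid\forall N\in\mathcal X,\ M\diamond N\Rightarrow MN\in\mathcal Y\}$. For $x\in\mathcal V_1$, $\mathcal N_x^0=\{x^0N_1\dots N_k\in\mathbb M\mid k\ge0\}$. An interpretation is a function $\mathcal I:\mathcal A\to\mathcal P(\mathcal M^0)$ with each $\mathcal I(a)$ saturated and $\mathcal N_x^0\subseteq\mathcal I(a)\subseteq\mathbb M^0$ for all $x\in\mathcal V_1$; extended by $\mathcal I(eU)=\mathcal I(U)^+$, $\mathcal I(U\sqcap V)=\mathcal I(U)\cap\mathcal I(V)$, $\mathcal I(U\to T)=\mathcal I(U)\leadsto\mathcal I(T)$. $[U]=\{M\in\mathcal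 M\mid M\text{ closed and }M\in\mathcal I(U)\text{ for every interpretation }\mathcal I\}$. -}

module Defs where

open import Data.Nat using (ℕ; zero; suc; _<_; _≤_; _⊔_; _⊓_; _<ᵇ_; _≡ᵇ_)
open import Data.Bool using (Bool; true; false; if_then_else_; _∧_)
open import Data.List using (List; []; _∷_; length)
open import Data.Maybe using (Maybe; just; nothing; Is-just)
open import Data.Product using (Σ; _×_; _,_)
open import Relation.Binary.PropositionalEquality using (_≡_)
open import Relation.Nullary using (¬_)

-- Variable names: 𝒱 = 𝒱₁ ∪ 𝒱₂ (disjoint, both denumerable)

data Name : Set where
  v₁ : ℕ → Name
  v₂ : ℕ → Name

_==ᴺ_ : Name → Name → Bool
v₁ i ==ᴺ v₁ j = i ≡ᵇ j
v₂ i ==ᴺ v₂ j = i ≡ᵇ j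
_    ==ᴺ _    = false

sameVar : Name → ℕ → Name → ℕ → Bool
sameVar x n y m = (x ==ᴺ y) ∧ (n ≡ᵇ m)

-- Raw terms, locally nameless representation (this takes care of
-- α-conversion): free indexed variables x^n are named, bound variables
-- are de Bruijn indices, and a binder λ n records the index n of the
-- variable it binds (λx^n.M).

data Tm : Set where
  fv  : Name → ℕ → Tm
  bv  : ℕ → Tm
  app : Tm → Tm → Tm
  lam : ℕ → Tm → Tm

-- i-th entry of a list of binder indices (default 0, never used on terms)
nth : List ℕ → ℕ → ℕ
nth []       _       = 0
nth (n ∷ _)  zero    = n
nth (_ ∷ ns) (suc i) = nth ns i

-- degree d(M), in a context listing the indices of the enclosing binders
deg : List ℕ → Tm → ℕ
deg Δ (fv x n)  = n
deg Δ (bv i)    = nth Δ i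
deg Δ (app M N) = deg Δ M ⊓ deg Δ N
deg Δ (lam n M) = deg (n ∷ Δ) M

data FreeIn (x : Name) (n : ℕ) : Tm → Set where
  here  : FreeIn x n (fv x n)
  appˡ  : ∀ {M N} → FreeIn x n M → FreeIn x n (app M N)
  appʳ  : ∀ {M N} → FreeIn x n N → FreeIn x n (app M N)
  under : ∀ {m M} → FreeIn x n M → FreeIn x n (lam m M)

data Occ : ℕ → Tm → Set where
  here  : ∀ {k} → Occ k (bv k)
  appˡ  : ∀ {k M N} → Occ k M → Occ k (app M N)
  appʳ  : ∀ {k M N} → Occ k N → Occ k (app M N)
  under : ∀ {k m M} → Occ (suc k) M → Occ k (lam m M)

Joinable : Tm → Tm → Set
Joinable M N = ∀ x m n → FreeIn x m M → FreeIn x n N → m ≡ n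

data IsTerm (Δ : List ℕ) : Tm → Set where
  fv  : ∀ x n → IsTerm Δ (fv x n)
  bv  : ∀ {i} → i < length Δ → IsTerm Δ (bv i)
  app : ∀ {M N} → IsTerm Δ M → IsTerm Δ N → Joinable M N → IsTerm Δ (app M N)
  lam : ∀ {n M} → IsTerm (n ∷ Δ) M → Occ 0 M → IsTerm Δ (lam n M)

data IsGood (Δ : List ℕ) : Tm → Set where
  fv  : ∀ x n → IsGood Δ (fv x n)
  bv  : ∀ {i} → i < length Δ → IsGood Δ (bv i)
  app : ∀ {M N} → IsGood Δ M → IsGood Δ N → Joinable M N →
        deg Δ M ≤ deg Δ N → IsGood Δ (app M N)
  lam : ∀ {n M} → IsGood (n ∷ Δ) M → Occ 0 M → IsGood Δ (lam n M)

𝓜 : Tm → Set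
𝓜 = IsTerm []

𝕄⁰ : Tm → Set
𝕄⁰ M = IsGood [] M × deg [] M ≡ 0

Closed : Tm → Set
Closed M = ∀ x n → ¬ FreeIn x n M

idTm : Tm
idTm = lam 0 (bv 0)

_⁺ : Tm → Tm
fv x n  ⁺ = fv x (suc n)
bv i    ⁺ = bv i
app M N ⁺ = app (M ⁺) (N ⁺)
lam n M ⁺ = lam (suc n) (M ⁺)

close : Name → ℕ → ℕ → Tm → Tm
close x n k (fv y m)  = if sameVar x n y m then bv k else fv y m
close x n k (bv i)    = bv i
close x n k (app M N) = app (close x n k M) (close x n k N)
close x n k (lam m M) = lam m (close x n (suc k) M)

ƛ : Name → ℕ → Tm → Tm
ƛ x n M = lam n (close x n 0 M)

shift : ℕ → Tm → Tm
shift c (fv x n)  = fv x n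
shift c (bv i)    = if i <ᵇ c then bv i else bv (suc i)
shift c (app M N) = app (shift c M) (shift c N)
shift c (lam n M) = lam n (shift (suc c) M)

predℕ : ℕ → ℕ
predℕ zero    = zero
predℕ (suc n) = n

subst : ℕ → Tm → Tm → Tm
subst k N (fv x n)  = fv x n
subst k N (bv i)    = if i ≡ᵇ k then N else (if i <ᵇ k then bv i else bv (predℕ i))
subst k N (app M P) = app (subst k N M) (subst k N P)
subst k N (lam n M) = lam n (subst (suc k) (shift 0 N) M)

data _⊢_▷β_ : List ℕ → Tm → Tm → Set where
  β    : ∀ {Δ n M N} → deg Δ N ≡ n → Δ ⊢ app (lam n M) N ▷β subst 0 N M
  appˡ : ∀ {Δ M M′ N} → Δ ⊢ M ▷β M′ → Δ ⊢ app M N ▷β app M′ N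
  appʳ : ∀ {Δ M N N′} → Δ ⊢ N ▷β N′ → Δ ⊢ app M N ▷β app M N′
  lam  : ∀ {Δ n M M′} → (n ∷ Δ) ⊢ M ▷β M′ → Δ ⊢ lam n M ▷β lam n M′

data _▷β*_ : Tm → Tm → Set where
  refl : ∀ {M} → M ▷β* M
  step : ∀ {M N P} → [] ⊢ M ▷β N → N ▷β* P → M ▷β* P

-- Types (raw; the quotient is handled by the congruence _≈_ below)
-- atoms 𝒜 = ℕ, expansion variables ℰ = ℕ

infixr 6 _⇒_
infixl 7 _∩_

data Ty : Set where
  at  : ℕ → Ty
  _⇒_ : Ty → Ty → Ty
  _∩_ : Ty → Ty → Ty
  ex  : ℕ → Ty → Ty

data _≈_ : Ty → Ty → Set where
  refl   : ∀ {U} → U ≈ U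
  sym    : ∀ {U V} → U ≈ V → V ≈ U
  trans  : ∀ {U V W} → U ≈ V → V ≈ W → U ≈ W
  ⇒-cong : ∀ {U U′ T T′} → U ≈ U′ → T ≈ T′ → (U ⇒ T) ≈ (U′ ⇒ T′)
  ∩-cong : ∀ {U U′ V V′} → U ≈ U′ → V ≈ V′ → (U ∩ V) ≈ (U′ ∩ V′)
  ex-cong : ∀ {e U U′} → U ≈ U′ → ex e U ≈ ex e U′
  ∩-comm  : ∀ {U V} → (U ∩ V) ≈ (V ∩ U)
  ∩-assoc : ∀ {U V W} → ((U ∩ V) ∩ W) ≈ (U ∩ (V ∩ W))
  ∩-idem  : ∀ {U} → (U ∩ U) ≈ U
  ex-distr : ∀ {e U V} → ex e (U ∩ V) ≈ (ex e U ∩ ex e V)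

degT : Ty → ℕ
degT (at a)   = 0
degT (U ⇒ T)  = degT U ⊓ degT T
degT (U ∩ V)  = degT U ⊓ degT V
degT (ex e U) = suc (degT U)

data GoodTy : Ty → Set where
  at : ∀ a → GoodTy (at a)
  ex : ∀ {e U} → GoodTy U → GoodTy (ex e U)
  g⇒ : ∀ {U T} → GoodTy U → GoodTy T → degT T ≤ degT U → GoodTy (U ⇒ T)
  g∩ : ∀ {U V} → GoodTy U → GoodTy V → degT U ≡ degT V → GoodTy (U ∩ V)

mutual
  data IsU : Ty → Set where
    u∩ : ∀ {U V} → IsU U → IsU V → IsU (U ∩ V)
    ex : ∀ {e U} → IsU U → IsU (ex e U)
    ut : ∀ {T} → IsT T → IsU T

  data IsT : Ty → Set where
    at : ∀ a → IsT (at a)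
    t⇒ : ∀ {U T} → IsU U → IsT T → IsT (U ⇒ T)

-- Environments: finite maps x^n ↦ type, as functions

Env : Set
Env = Name → ℕ → Maybe Ty

∅ : Env
∅ _ _ = nothing

single : Name → ℕ → Ty → Env
single x n T y m = if sameVar x n y m then just T else nothing

extend : Env → Name → ℕ → Ty → Env
extend Γ x n U y m = if sameVar x n y m then just U else Γ y m

_⊓ᴱ_ : Env → Env → Env
(Γ₁ ⊓ᴱ Γ₂) y m with Γ₁ y m | Γ₂ y m
... | just U  | just V  = just (U ∩ V)
... | just U  | nothing = just U
... | nothing | just V  = just V
... | nothing | nothing = nothing

exᴱ : ℕ → Env → Env
exᴱ e Γ y zero    = nothing
exᴱ e Γ y (suc n) with Γ y n
... | just U  = just (ex e U)
... | nothing = nothing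

_⋄ᴱ_ : Env → Env → Set
Γ₁ ⋄ᴱ Γ₂ = ∀ x m n → Is-just (Γ₁ x m) → Is-just (Γ₂ x n) → m ≡ n

data _≈ᴹ_ : Maybe Ty → Maybe Ty → Set where
  nothing : nothing ≈ᴹ nothing
  just    : ∀ {U V} → U ≈ V → just U ≈ᴹ just V

_≈ᴱ_ : Env → Env → Set
Γ ≈ᴱ Γ′ = ∀ y m → Γ y m ≈ᴹ Γ′ y m

-- Typing system ⊢₁ (closure under ≈ reflects that types and
-- environments are taken as equivalence classes)

data _∶⟨_⊢₁_⟩ : Tm → Env → Ty → Set where
  ax  : ∀ {x n T} → GoodTy T → degT T ≡ n → fv x n ∶⟨ single x n T ⊢₁ T ⟩
  ⇒I  : ∀ {M Γ x n U T} → Γ x n ≡ nothing →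
        M ∶⟨ extend Γ x n U ⊢₁ T ⟩ → ƛ x n M ∶⟨ Γ ⊢₁ U ⇒ T ⟩
  ⇒E  : ∀ {M₁ M₂ Γ₁ Γ₂ U T} → M₁ ∶⟨ Γ₁ ⊢₁ U ⇒ T ⟩ → M₂ ∶⟨ Γ₂ ⊢₁ U ⟩ →
        Γ₁ ⋄ᴱ Γ₂ → app M₁ M₂ ∶⟨ Γ₁ ⊓ᴱ Γ₂ ⊢₁ T ⟩
  ∩I  : ∀ {M Γ₁ Γ₂ U₁ U₂} → M ∶⟨ Γ₁ ⊢₁ U₁ ⟩ → M ∶⟨ Γ₂ ⊢₁ U₂ ⟩ →
        M ∶⟨ Γ₁ ⊓ᴱ Γ₂ ⊢₁ U₁ ∩ U₂ ⟩
  exp : ∀ {M Γ U} e → M ∶⟨ Γ ⊢₁ U ⟩ → (M ⁺) ∶⟨ exᴱ e Γ ⊢₁ ex e U ⟩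
  cls : ∀ {M Γ Γ′ U U′} → M ∶⟨ Γ ⊢₁ U ⟩ → Γ ≈ᴱ Γ′ → U ≈ U′ → M ∶⟨ Γ′ ⊢₁ U′ ⟩

data _⊑_ : Ty → Ty → Set where
  refl  : ∀ {U V} → IsU U → U ≈ V → U ⊑ V
  trans : ∀ {U V W} → U ⊑ V → V ⊑ W → U ⊑ W
  ∩-lb  : ∀ {U₁ U₂} → IsU U₁ → IsU U₂ → GoodTy U₂ → degT U₁ ≡ degT U₂ →
          (U₁ ∩ U₂) ⊑ U₁
  ∩-mono : ∀ {U₁ U₂ V₁ V₂} → U₁ ⊑ V₁ → U₂ ⊑ V₂ → (U₁ ∩ U₂) ⊑ (V₁ ∩ V₂)
  ⇒-mono : ∀ {U₁ U₂ T₁ T₂} → IsT T₁ → IsT T₂ → U₂ ⊑ U₁ → T₁ ⊑ T₂ →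
           (U₁ ⇒ T₁) ⊑ (U₂ ⇒ T₂)
  ex-mono : ∀ {e U₁ U₂} → U₁ ⊑ U₂ → ex e U₁ ⊑ ex e U₂

data _⊑ᴱ_ : Env → Env → Set where
  refl  : ∀ {Γ Γ′} → Γ ≈ᴱ Γ′ → Γ ⊑ᴱ Γ′
  trans : ∀ {Γ₁ Γ₂ Γ₃} → Γ₁ ⊑ᴱ Γ₂ → Γ₂ ⊑ᴱ Γ₃ → Γ₁ ⊑ᴱ Γ₃
  pt    : ∀ {Γ y n U₁ U₂} → Γ y n ≡ nothing → U₁ ⊑ U₂ →
          extend Γ y n U₁ ⊑ᴱ extend Γ y n U₂

data _⊑ᵀ_ : Env × Ty → Env × Ty → Set where
  refl  : ∀ {Γ U} → (Γ , U) ⊑ᵀ (Γ , U)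
  trans : ∀ {t₁ t₂ t₃} → t₁ ⊑ᵀ t₂ → t₂ ⊑ᵀ t₃ → t₁ ⊑ᵀ t₃
  typ   : ∀ {Γ₁ Γ₂ U₁ U₂} → U₁ ⊑ U₂ → Γ₂ ⊑ᴱ Γ₁ → (Γ₁ , U₁) ⊑ᵀ (Γ₂ , U₂)

data _∶⟨_⊢₂_⟩ : Tm → Env → Ty → Set where
  ax  : ∀ {x T} → IsT T → GoodTy T → fv x 0 ∶⟨ single x 0 T ⊢₂ T ⟩
  ⇒I  : ∀ {M Γ x n U T} → IsU U → IsT T → Γ x n ≡ nothing →
        M ∶⟨ extend Γ x n U ⊢₂ T ⟩ → ƛ x n M ∶⟨ Γ ⊢₂ U ⇒ T ⟩
  ⇒E  : ∀ {M₁ M₂ Γ₁ Γ₂ U T} → IsU U → IsT T →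
        M₁ ∶⟨ Γ₁ ⊢₂ U ⇒ T ⟩ → M₂ ∶⟨ Γ₂ ⊢₂ U ⟩ →
        Γ₁ ⋄ᴱ Γ₂ → app M₁ M₂ ∶⟨ Γ₁ ⊓ᴱ Γ₂ ⊢₂ T ⟩
  ∩I  : ∀ {M Γ₁ Γ₂ U₁ U₂} → IsU U₁ → IsU U₂ →
        M ∶⟨ Γ₁ ⊢₂ U₁ ⟩ → M ∶⟨ Γ₂ ⊢₂ U₂ ⟩ → M ∶⟨ Γ₁ ⊓ᴱ Γ₂ ⊢₂ U₁ ∩ U₂ ⟩
  exp : ∀ {M Γ U} e → IsU U → M ∶⟨ Γ ⊢₂ U ⟩ → (M ⁺) ∶⟨ exᴱ e Γ ⊢₂ ex e U ⟩
  sub : ∀ {M Γ Γ′ U U′} → M ∶⟨ Γ ⊢₂ U ⟩ → (Γ , U) ⊑ᵀ (Γ′ , U′) →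
        M ∶⟨ Γ′ ⊢₂ U′ ⟩

Pred : Set₁
Pred = Tm → Set

Saturated : Pred → Set
Saturated X = ∀ M N → 𝓜 M → M ▷β* N → X N → X M

_⁺ˢ : Pred → Pred
(X ⁺ˢ) M = Σ Tm λ N → X N × M ≡ N ⁺

_⇝_ : Pred → Pred → Pred
(X ⇝ Y) M = 𝓜 M × (∀ N → X N → Joinable M N → Y (app M N))

data Spine (x : Name) : Tm → Set where
  head : Spine x (fv x 0)
  app  : ∀ {M N} → Spine x M → Spine x (app M N)

𝓝⁰ : Name → Pred
𝓝⁰ x M = Spine x M × IsGood [] M

record Interpretation : Set₁ where
  field
    I     : ℕ → Pred
    sat   : ∀ a → Saturated (I a)
    neut  : ∀ a k M → 𝓝⁰ (v₁ k) M → I a M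
    inM   : ∀ a M → I a M → 𝕄⁰ M

⟦_∣_⟧ : Interpretation → Ty → Pred
⟦ 𝓘 ∣ at a ⟧   = Interpretation.I 𝓘 a
⟦ 𝓘 ∣ U ⇒ T ⟧  = ⟦ 𝓘 ∣ U ⟧ ⇝ ⟦ 𝓘 ∣ T ⟧
⟦ 𝓘 ∣ U ∩ V ⟧  = λ M → ⟦ 𝓘 ∣ U ⟧ M × ⟦ 𝓘 ∣ V ⟧ M
⟦ 𝓘 ∣ ex e U ⟧ = ⟦ 𝓘 ∣ U ⟧ ⁺ˢ

⟪_⟫ : Ty → Tm → Set₁
⟪ U ⟫ M = 𝓜 M × Closed M × ((𝓘 : Interpretation) → ⟦ 𝓘 ∣ U ⟧ M)

-- (1) [(a⊓b)→a] is exactly the set of good degree-0 terms reducing to λy⁰.y⁰.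
--     "⊇": such an M satisfies M N ▷β* (λy⁰.y⁰) N ▷β N, so saturation of
--     every 𝓘(a) puts M N into 𝓘(a) whenever N ∈ 𝓘(a) ∩ 𝓘(b).
--     "⊆": we use one particular interpretation 𝓘₀ in which every atom
--     denotes the good degree-0 terms reducing either to a 𝒱₁-neutral term or
--     to a probe variable y₀ ∈ 𝒱₂.  Then M y₀ ∈ 𝓘₀(a), so M y₀ is good (hence
--     so is M, with d(M) = 0) and, M being closed, M y₀ ▷β* y₀; abstracting y₀
--     in that reduction shows M ▷β* λy⁰.y⁰.  Saturation of 𝓘₀ is the heart of
--     the metatheory: β-reduction preserves well-formedness and degree, and
--     goodness is reflected by β-expansion.
-- (2) In ⊢₁ every type of λy⁰.y⁰ is "balanced": in each top-level arrow the
--     domain and codomain agree on whether b is a top-level ⊓-component; this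
--     is invariant under the type equations, and (a⊓b)→a is not balanced.
-- (3) In ⊢₂ the subsumption x⁰:a⊓b ⊑ x⁰:a turns the axiom x⁰:a into the goal.
module Submission where

open import Defs
open import Data.Nat using (ℕ; zero; suc; _<_; _≤_; _⊓_; _<ᵇ_; _≡ᵇ_; z≤n; s≤s)
open import Data.Nat.Properties
  using (≤-refl; ≤-trans; ≤-reflexive; ≤-pred; <-≤-trans; <-cmp; _<?_; ≮⇒≥;
         <⇒≤; <⇒≢; n≤1+n; <-irrefl; m⊓n≤m; m⊓n≤n; m≤n⇒m⊓n≡m; n≤0⇒n≡0)
open import Data.Bool using (Bool; true; false; _∨_; _xor_)
open import Data.Bool.Properties using (∨-comm; ∨-assoc; ∨-idem)
open import Data.List using (List; []; _∷_; length)
open import Data.Maybe using (Maybe; just)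
open import Data.Product using (Σ; _×_; _,_; proj₁; proj₂)
open import Data.Sum using (_⊎_; inj₁; inj₂)
open import Data.Empty using (⊥; ⊥-elim)
open import Relation.Binary.Definitions using (tri<; tri≈; tri>)
open import Relation.Binary.PropositionalEquality
  using (_≡_; refl; cong; cong₂; _≢_) renaming (sym to ≡sym; trans to ≡trans; subst to ≡subst)
open import Relation.Binary.Construct.Closure.ReflexiveTransitive using (Star; ε; _◅_)
open import Relation.Nullary using (¬_; yes; no)

≡ᵇ-refl : ∀ k → (k ≡ᵇ k) ≡ true
≡ᵇ-refl zero    = refl
≡ᵇ-refl (suc k) = ≡ᵇ-refl k

≡ᵇ-true : ∀ i k → (i ≡ᵇ k) ≡ true → i ≡ k
≡ᵇ-true zero    zero    _ = refl
≡ᵇ-true (suc i) (suc k) e = cong suc (≡ᵇ-true i k e)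

≢⇒≡ᵇ-false : ∀ i k → i ≢ k → (i ≡ᵇ k) ≡ false
≢⇒≡ᵇ-false zero    zero    i≢k = ⊥-elim (i≢k refl)
≢⇒≡ᵇ-false zero    (suc k) _   = refl
≢⇒≡ᵇ-false (suc i) zero    _   = refl
≢⇒≡ᵇ-false (suc i) (suc k) i≢k = ≢⇒≡ᵇ-false i k (λ e → i≢k (cong suc e))

<⇒<ᵇ-true : ∀ {i k} → i < k → (i <ᵇ k) ≡ true
<⇒<ᵇ-true {zero}  {suc k} _         = refl
<⇒<ᵇ-true {suc i} {suc k} (s≤s i<k) = <⇒<ᵇ-true i<k

≥⇒<ᵇ-false : ∀ {i k} → k ≤ i → (i <ᵇ k) ≡ false
≥⇒<ᵇ-false {i}     {zero}  _         = refl
≥⇒<ᵇ-false {suc i} {suc k} (s≤s k≤i) = ≥⇒<ᵇ-false k≤i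

subst-bv-here : ∀ k N → subst k N (bv k) ≡ N
subst-bv-here k N rewrite ≡ᵇ-refl k = refl

subst-bv-below : ∀ {i k} N → i < k → subst k N (bv i) ≡ bv i
subst-bv-below {i} {k} N i<k rewrite ≢⇒≡ᵇ-false i k (<⇒≢ i<k) | <⇒<ᵇ-true i<k = refl

subst-bv-above : ∀ {i k} N → k < i → subst k N (bv i) ≡ bv (predℕ i)
subst-bv-above {i} {k} N k<i
  rewrite ≢⇒≡ᵇ-false i k (λ e → <⇒≢ k<i (≡sym e)) | ≥⇒<ᵇ-false (<⇒≤ k<i) = refl

shift-bv-below : ∀ {i c} → i < c → shift c (bv i) ≡ bv i
shift-bv-below i<c rewrite <⇒<ᵇ-true i<c = refl

shift-bv-above : ∀ {i c} → c ≤ i → shift c (bv i) ≡ bv (suc i)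
shift-bv-above c≤i rewrite ≥⇒<ᵇ-false c≤i = refl

-- Binder contexts.  shift c inserts a binder at position c, subst k
-- removes the binder at position k; these are the matching operations on
-- the list of binder indices (insert pads with 0 past the end).

insert : ℕ → ℕ → List ℕ → List ℕ
insert zero    m Δ       = m ∷ Δ
insert (suc c) m []      = 0 ∷ insert c m []
insert (suc c) m (d ∷ Δ) = d ∷ insert c m Δ

delete : ℕ → List ℕ → List ℕ
delete _       []      = []
delete zero    (d ∷ Δ) = Δ
delete (suc k) (d ∷ Δ) = d ∷ delete k Δ

nth-[] : ∀ i → nth [] i ≡ 0
nth-[] zero    = refl
nth-[] (suc i) = refl

nth-insert-below : ∀ c m Δ i → i < c → nth (insert c m Δ) i ≡ nth Δ i
nth-insert-below (suc c) m []      zero    _         = refl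
nth-insert-below (suc c) m []      (suc i) (s≤s i<c) = nth-insert-below c m [] i i<c
nth-insert-below (suc c) m (d ∷ Δ) zero    _         = refl
nth-insert-below (suc c) m (d ∷ Δ) (suc i) (s≤s i<c) = nth-insert-below c m Δ i i<c

nth-insert-above : ∀ c m Δ i → c ≤ i → nth (insert c m Δ) (suc i) ≡ nth Δ i
nth-insert-above zero    m Δ       i       _         = refl
nth-insert-above (suc c) m []      (suc i) (s≤s c≤i) = nth-insert-above c m [] i c≤i
nth-insert-above (suc c) m (d ∷ Δ) (suc i) (s≤s c≤i) = nth-insert-above c m Δ i c≤i

nth-delete-below : ∀ k Δ i → i < k → nth (delete k Δ) i ≡ nth Δ i
nth-delete-below k       []      i       _         = refl
nth-delete-below (suc k) (d ∷ Δ) zero    _         = refl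
nth-delete-below (suc k) (d ∷ Δ) (suc i) (s≤s i<k) = nth-delete-below k Δ i i<k

nth-delete-above : ∀ k Δ i → k < i → nth (delete k Δ) (predℕ i) ≡ nth Δ i
nth-delete-above zero    []      (suc i)       _         = nth-[] i
nth-delete-above (suc k) []      (suc i)       _         = nth-[] i
nth-delete-above zero    (d ∷ Δ) (suc i)       _         = refl
nth-delete-above (suc k) (d ∷ Δ) (suc (suc i)) (s≤s k<i) = nth-delete-above k Δ (suc i) k<i

length-insert : ∀ c m Δ → c ≤ length Δ → length (insert c m Δ) ≡ suc (length Δ)
length-insert zero    m Δ       _         = refl
length-insert (suc c) m (d ∷ Δ) (s≤s c≤n) = cong suc (length-insert c m Δ c≤n)

length-delete : ∀ k Δ → k < length Δ → suc (length (delete k Δ)) ≡ length Δ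
length-delete zero    (d ∷ Δ) _         = refl
length-delete (suc k) (d ∷ Δ) (s≤s k<n) = cong suc (length-delete k Δ k<n)

deg-shift : ∀ c m Δ P → deg (insert c m Δ) (shift c P) ≡ deg Δ P
deg-shift c m Δ (fv x n) = refl
deg-shift c m Δ (bv i) with i <? c
... | yes i<c rewrite shift-bv-below i<c = nth-insert-below c m Δ i i<c
... | no  i≮c rewrite shift-bv-above (≮⇒≥ i≮c) = nth-insert-above c m Δ i (≮⇒≥ i≮c)
deg-shift c m Δ (app P Q) = cong₂ _⊓_ (deg-shift c m Δ P) (deg-shift c m Δ Q)
deg-shift c m Δ (lam n P) = deg-shift (suc c) m (n ∷ Δ) P

deg-subst : ∀ k Δ N B → deg (delete k Δ) N ≡ nth Δ k →
            deg (delete k Δ) (subst k N B) ≡ deg Δ B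
deg-subst k Δ N (fv x n) _ = refl
deg-subst k Δ N (bv i) dN with <-cmp i k
... | tri< i<k _ _ rewrite subst-bv-below N i<k = nth-delete-below k Δ i i<k
... | tri≈ _ refl _ rewrite subst-bv-here i N = dN
... | tri> _ _ k<i rewrite subst-bv-above N k<i = nth-delete-above k Δ i k<i
deg-subst k Δ N (app P Q) dN = cong₂ _⊓_ (deg-subst k Δ N P dN) (deg-subst k Δ N Q dN)
deg-subst k Δ N (lam m B) dN =
  deg-subst (suc k) (m ∷ Δ) (shift 0 N) B (≡trans (deg-shift 0 m (delete k Δ) N) dN)

deg-occ : ∀ {k B} Δ → Occ k B → deg Δ B ≤ nth Δ k
deg-occ Δ here                = ≤-refl
deg-occ Δ (appˡ o)            = ≤-trans (m⊓n≤m _ _) (deg-occ Δ o)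
deg-occ Δ (appʳ o)            = ≤-trans (m⊓n≤n _ _) (deg-occ Δ o)
deg-occ Δ (under {m = m} o)   = deg-occ (m ∷ Δ) o

_≗ⁿ_ : List ℕ → List ℕ → Set
Δ ≗ⁿ Δ′ = ∀ i → nth Δ i ≡ nth Δ′ i

≗ⁿ-extend : ∀ {Δ Δ′} n → Δ ≗ⁿ Δ′ → (n ∷ Δ) ≗ⁿ (n ∷ Δ′)
≗ⁿ-extend n h zero    = refl
≗ⁿ-extend n h (suc i) = h i

deg-≗ⁿ : ∀ {Δ Δ′} → Δ ≗ⁿ Δ′ → ∀ P → deg Δ P ≡ deg Δ′ P
deg-≗ⁿ h (fv x n)  = refl
deg-≗ⁿ h (bv i)    = h i
deg-≗ⁿ h (app P Q) = cong₂ _⊓_ (deg-≗ⁿ h P) (deg-≗ⁿ h Q)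
deg-≗ⁿ h (lam n P) = deg-≗ⁿ (≗ⁿ-extend n h) P

module _ {x : Name} {n : ℕ} where
  fv-shift : ∀ c P → FreeIn x n P → FreeIn x n (shift c P)
  fv-shift c (fv y m)  here      = here
  fv-shift c (app P Q) (appˡ p)  = appˡ (fv-shift c P p)
  fv-shift c (app P Q) (appʳ p)  = appʳ (fv-shift c Q p)
  fv-shift c (lam m P) (under p) = under (fv-shift (suc c) P p)

  fv-shift⁻ : ∀ c P → FreeIn x n (shift c P) → FreeIn x n P
  fv-shift⁻ c (fv y m)  p         = p
  fv-shift⁻ c (bv i)    p with i <ᵇ c
  fv-shift⁻ c (bv i)    () | true
  fv-shift⁻ c (bv i)    () | false
  fv-shift⁻ c (app P Q) (appˡ p)  = appˡ (fv-shift⁻ c P p)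
  fv-shift⁻ c (app P Q) (appʳ p)  = appʳ (fv-shift⁻ c Q p)
  fv-shift⁻ c (lam m P) (under p) = under (fv-shift⁻ (suc c) P p)

  fv-subst-body : ∀ k N B → FreeIn x n B → FreeIn x n (subst k N B)
  fv-subst-body k N (fv y m)  here      = here
  fv-subst-body k N (app P Q) (appˡ p)  = appˡ (fv-subst-body k N P p)
  fv-subst-body k N (app P Q) (appʳ p)  = appʳ (fv-subst-body k N Q p)
  fv-subst-body k N (lam m P) (under p) = under (fv-subst-body (suc k) (shift 0 N) P p)

  fv-subst-arg : ∀ {k} N B → Occ k B → FreeIn x n N → FreeIn x n (subst k N B)
  fv-subst-arg {k} N (bv .k)  here      p rewrite subst-bv-here k N = p
  fv-subst-arg N (app P Q)    (appˡ o)  p = appˡ (fv-subst-arg N P o p)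
  fv-subst-arg N (app P Q)    (appʳ o)  p = appʳ (fv-subst-arg N Q o p)
  fv-subst-arg N (lam m P)    (under o) p = under (fv-subst-arg (shift 0 N) P o (fv-shift 0 N p))

  fv-subst⁻ : ∀ k N B → FreeIn x n (subst k N B) → FreeIn x n B ⊎ FreeIn x n N
  fv-subst⁻ k N (fv y m) p = inj₁ p
  fv-subst⁻ k N (bv i) p with i ≡ᵇ k
  ... | true = inj₂ p
  ... | false with i <ᵇ k
  fv-subst⁻ k N (bv i) () | false | true
  fv-subst⁻ k N (bv i) () | false | false
  fv-subst⁻ k N (app P Q) (appˡ p) with fv-subst⁻ k N P p
  ... | inj₁ q = inj₁ (appˡ q)
  ... | inj₂ q = inj₂ q
  fv-subst⁻ k N (app P Q) (appʳ p) with fv-subst⁻ k N Q p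
  ... | inj₁ q = inj₁ (appʳ q)
  ... | inj₂ q = inj₂ q
  fv-subst⁻ k N (lam m P) (under p) with fv-subst⁻ (suc k) (shift 0 N) P p
  ... | inj₁ q = inj₁ (under q)
  ... | inj₂ q = inj₂ (fv-shift⁻ 0 N q)

occ-shift-below : ∀ {j} c P → Occ j P → j < c → Occ j (shift c P)
occ-shift-below c (bv j)    here      j<c rewrite shift-bv-below j<c = here
occ-shift-below c (app P Q) (appˡ o)  j<c = appˡ (occ-shift-below c P o j<c)
occ-shift-below c (app P Q) (appʳ o)  j<c = appʳ (occ-shift-below c Q o j<c)
occ-shift-below c (lam m P) (under o) j<c = under (occ-shift-below (suc c) P o (s≤s j<c))

occ-shift-above : ∀ {j} c P → Occ j P → c ≤ j → Occ (suc j) (shift c P)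
occ-shift-above c (bv j)    here      c≤j rewrite shift-bv-above c≤j = here
occ-shift-above c (app P Q) (appˡ o)  c≤j = appˡ (occ-shift-above c P o c≤j)
occ-shift-above c (app P Q) (appʳ o)  c≤j = appʳ (occ-shift-above c Q o c≤j)
occ-shift-above c (lam m P) (under o) c≤j = under (occ-shift-above (suc c) P o (s≤s c≤j))

occ-shift⁻ : ∀ {j} c P → Occ j (shift c P) → j < c → Occ j P
occ-shift⁻ c (fv y m) () _
occ-shift⁻ {j} c (bv i) o j<c with i <? c
... | yes i<c with ≡subst (Occ j) (shift-bv-below i<c) o
...   | here = here
occ-shift⁻ {j} c (bv i) o j<c | no i≮c with ≡subst (Occ j) (shift-bv-above (≮⇒≥ i≮c)) o
...   | here = ⊥-elim (<-irrefl refl (≤-trans j<c (≤-trans (≮⇒≥ i≮c) (n≤1+n _))))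
occ-shift⁻ c (app P Q) (appˡ o)  j<c = appˡ (occ-shift⁻ c P o j<c)
occ-shift⁻ c (app P Q) (appʳ o)  j<c = appʳ (occ-shift⁻ c Q o j<c)
occ-shift⁻ c (lam m P) (under o) j<c = under (occ-shift⁻ (suc c) P o (s≤s j<c))

occ-subst-below : ∀ {j} k N B → Occ j B → j < k → Occ j (subst k N B)
occ-subst-below k N (bv j)    here      j<k rewrite subst-bv-below N j<k = here
occ-subst-below k N (app P Q) (appˡ o)  j<k = appˡ (occ-subst-below k N P o j<k)
occ-subst-below k N (app P Q) (appʳ o)  j<k = appʳ (occ-subst-below k N Q o j<k)
occ-subst-below k N (lam m P) (under o) j<k =
  under (occ-subst-below (suc k) (shift 0 N) P o (s≤s j<k))

occ-subst-above : ∀ {j} k N B → Occ (suc j) B → k ≤ j → Occ j (subst k N B)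
occ-subst-above k N (bv (suc j)) here      k≤j rewrite subst-bv-above N (s≤s k≤j) = here
occ-subst-above k N (app P Q)    (appˡ o)  k≤j = appˡ (occ-subst-above k N P o k≤j)
occ-subst-above k N (app P Q)    (appʳ o)  k≤j = appʳ (occ-subst-above k N Q o k≤j)
occ-subst-above k N (lam m P)    (under o) k≤j =
  under (occ-subst-above (suc k) (shift 0 N) P o (s≤s k≤j))

occ-subst-arg : ∀ {j k} N B → Occ k B → Occ j N → Occ j (subst k N B)
occ-subst-arg {k = k} N (bv .k) here      o′ rewrite subst-bv-here k N = o′
occ-subst-arg N (app P Q)       (appˡ o)  o′ = appˡ (occ-subst-arg N P o o′)
occ-subst-arg N (app P Q)       (appʳ o)  o′ = appʳ (occ-subst-arg N Q o o′)
occ-subst-arg N (lam m P)       (under o) o′ =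
  under (occ-subst-arg (shift 0 N) P o (occ-shift-above 0 N o′ z≤n))

joinable-self : ∀ {Δ P} → IsTerm Δ P → Joinable P P
joinable-self (fv x n)      .x .n .n here     here     = refl
joinable-self (app tP tQ j) x a b (appˡ p) (appˡ q) = joinable-self tP x a b p q
joinable-self (app tP tQ j) x a b (appˡ p) (appʳ q) = j x a b p q
joinable-self (app tP tQ j) x a b (appʳ p) (appˡ q) = ≡sym (j x b a q p)
joinable-self (app tP tQ j) x a b (appʳ p) (appʳ q) = joinable-self tQ x a b p q
joinable-self (lam t o)     x a b (under p) (under q) = joinable-self t x a b p q

good⇒term : ∀ {Δ M} → IsGood Δ M → IsTerm Δ M
good⇒term (fv x n)       = fv x n
good⇒term (bv i<n)       = bv i<n
good⇒term (app g g′ j _) = app (good⇒term g) (good⇒term g′) j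
good⇒term (lam g o)      = lam (good⇒term g) o

term-shift : ∀ {Δ} c m P → IsTerm Δ P → c ≤ length Δ → IsTerm (insert c m Δ) (shift c P)
term-shift c m (fv x n) _ _ = fv x n
term-shift {Δ} c m (bv i) (bv i<n) c≤n with i <? c
... | yes i<c rewrite shift-bv-below i<c =
  bv (≤-trans i<n (≤-trans (n≤1+n _) (≤-reflexive (≡sym (length-insert c m Δ c≤n)))))
... | no  i≮c rewrite shift-bv-above (≮⇒≥ i≮c) =
  bv (≤-trans (s≤s i<n) (≤-reflexive (≡sym (length-insert c m Δ c≤n))))
term-shift c m (app P Q) (app tP tQ j) c≤n =
  app (term-shift c m P tP c≤n) (term-shift c m Q tQ c≤n)
      (λ x a b p q → j x a b (fv-shift⁻ c P p) (fv-shift⁻ c Q q))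
term-shift c m (lam n P) (lam t o) c≤n =
  lam (term-shift (suc c) m P t (s≤s c≤n)) (occ-shift-below (suc c) P o (s≤s z≤n))

term-subst : ∀ {Δ} k N B → IsTerm Δ B → IsTerm (delete k Δ) N → k < length Δ →
             Joinable B N → Joinable N N → IsTerm (delete k Δ) (subst k N B)
term-subst k N (fv x n) _ _ _ _ _ = fv x n
term-subst {Δ} k N (bv i) (bv i<n) tN k<n _ _ with <-cmp i k
... | tri< i<k _ _ rewrite subst-bv-below N i<k =
  bv (<-≤-trans i<k (≤-pred (≤-trans k<n (≤-reflexive (≡sym (length-delete k Δ k<n))))))
... | tri≈ _ refl _ rewrite subst-bv-here i N = tN
... | tri> _ _ k<i rewrite subst-bv-above N k<i =
  bv (pred-below k<i (≤-trans i<n (≤-reflexive (≡sym (length-delete k Δ k<n)))))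
  where
  pred-below : ∀ {k i n} → k < i → i < suc n → predℕ i < n
  pred-below {i = suc i} _ (s≤s i<n) = i<n
term-subst k N (app P Q) (app tP tQ j) tN k<n jB jN =
  app (term-subst k N P tP tN k<n (λ x a b p q → jB x a b (appˡ p) q) jN)
      (term-subst k N Q tQ tN k<n (λ x a b p q → jB x a b (appʳ p) q) jN)
      joinable-parts
  where
  joinable-parts : Joinable (subst k N P) (subst k N Q)
  joinable-parts x a b p q with fv-subst⁻ k N P p | fv-subst⁻ k N Q q
  ... | inj₁ p′ | inj₁ q′ = j x a b p′ q′
  ... | inj₁ p′ | inj₂ q′ = jB x a b (appˡ p′) q′
  ... | inj₂ p′ | inj₁ q′ = ≡sym (jB x b a (appʳ q′) p′)
  ... | inj₂ p′ | inj₂ q′ = jN x a b p′ q′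
term-subst k N (lam m B) (lam t o) tN k<n jB jN =
  lam (term-subst (suc k) (shift 0 N) B t (term-shift 0 m N tN z≤n) (s≤s k<n)
         (λ x a b p q → jB x a b (under p) (fv-shift⁻ 0 N q))
         (λ x a b p q → jN x a b (fv-shift⁻ 0 N p) (fv-shift⁻ 0 N q)))
      (occ-subst-below (suc k) (shift 0 N) B o (s≤s z≤n))

fv-step⁻ : ∀ {Δ M N x n} → Δ ⊢ M ▷β N → FreeIn x n N → FreeIn x n M
fv-step⁻ (β {M = B} {N = N} _) p with fv-subst⁻ 0 N B p
... | inj₁ q = appˡ (under q)
... | inj₂ q = appʳ q
fv-step⁻ (appˡ s) (appˡ p)  = appˡ (fv-step⁻ s p)
fv-step⁻ (appˡ s) (appʳ p)  = appʳ p
fv-step⁻ (appʳ s) (appˡ p)  = appˡ p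
fv-step⁻ (appʳ s) (appʳ p)  = appʳ (fv-step⁻ s p)
fv-step⁻ (lam s)  (under p) = under (fv-step⁻ s p)

-- on λI-terms (every binder binds an occurrence) no free variable is lost
fv-step : ∀ {Δ M N x n} → IsTerm Δ M → Δ ⊢ M ▷β N → FreeIn x n M → FreeIn x n N
fv-step (app (lam _ _) _ _) (β {M = B} {N = N} _) (appˡ (under p)) = fv-subst-body 0 N B p
fv-step (app (lam _ o) _ _) (β {M = B} {N = N} _) (appʳ p)         = fv-subst-arg N B o p
fv-step (app tM _ _) (appˡ s) (appˡ p)  = appˡ (fv-step tM s p)
fv-step (app _ _ _)  (appˡ s) (appʳ p)  = appʳ p
fv-step (app _ _ _)  (appʳ s) (appˡ p)  = appˡ p
fv-step (app _ tN _) (appʳ s) (appʳ p)  = appʳ (fv-step tN s p)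
fv-step (lam t _)    (lam s)  (under p) = under (fv-step t s p)

occ-step : ∀ {Δ M N j} → IsTerm Δ M → Δ ⊢ M ▷β N → Occ j M → Occ j N
occ-step (app (lam _ _) _ _) (β {M = B} {N = N} _) (appˡ (under o′)) = occ-subst-above 0 N B o′ z≤n
occ-step (app (lam _ o) _ _) (β {M = B} {N = N} _) (appʳ o′)         = occ-subst-arg N B o o′
occ-step (app tM _ _) (appˡ s) (appˡ o)  = appˡ (occ-step tM s o)
occ-step (app _ _ _)  (appˡ s) (appʳ o)  = appʳ o
occ-step (app _ _ _)  (appʳ s) (appˡ o)  = appˡ o
occ-step (app _ tN _) (appʳ s) (appʳ o)  = appʳ (occ-step tN s o)
occ-step (lam t _)    (lam s)  (under o) = under (occ-step t s o)

term-step : ∀ {Δ M N} → IsTerm Δ M → Δ ⊢ M ▷β N → IsTerm Δ N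
term-step (app (lam t o) tN j) (β {M = B} {N = N} _) =
  term-subst 0 N B t tN (s≤s z≤n) (λ x a b p q → j x a b (under p) q) (joinable-self tN)
term-step (app tM tN j) (appˡ s) =
  app (term-step tM s) tN (λ x a b p q → j x a b (fv-step⁻ s p) q)
term-step (app tM tN j) (appʳ s) =
  app tM (term-step tN s) (λ x a b p q → j x a b p (fv-step⁻ s q))
term-step (lam t o) (lam s) = lam (term-step t s) (occ-step t s o)

-- β-reduction preserves degrees; for the redex, d((λx^n.B)N) = d(B) since
-- x^n occurs in B, so d(B) ≤ n = d(N)
deg-step : ∀ {Δ M N} → IsTerm Δ M → Δ ⊢ M ▷β N → deg Δ N ≡ deg Δ M
deg-step {Δ} (app (lam {n = n} _ o) _ _) (β {M = B} {N = N} dN) =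
  ≡trans (deg-subst 0 (n ∷ Δ) N B dN)
         (≡sym (m≤n⇒m⊓n≡m (≤-trans (deg-occ (n ∷ Δ) o) (≤-reflexive (≡sym dN)))))
deg-step {Δ} (app {N = N} tM _ _) (appˡ s) = cong (_⊓ deg Δ N) (deg-step tM s)
deg-step {Δ} (app {M = M} _ tN _) (appʳ s) = cong (deg Δ M ⊓_) (deg-step tN s)
deg-step (lam t _) (lam s) = deg-step t s

good-unshift : ∀ {Δ} c m P → IsGood (insert c m Δ) (shift c P) → c ≤ length Δ → IsGood Δ P
good-unshift c m (fv x n) _ _ = fv x n
good-unshift {Δ} c m (bv i) g c≤n with i <? c
... | yes i<c = bv (<-≤-trans i<c c≤n)
... | no  i≮c with ≡subst (IsGood _) (shift-bv-above (≮⇒≥ i≮c)) g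
...   | bv i<n = bv (≤-pred (≤-trans i<n (≤-reflexive (length-insert c m Δ c≤n))))
good-unshift {Δ} c m (app P Q) (app gP gQ j d) c≤n =
  app (good-unshift c m P gP c≤n) (good-unshift c m Q gQ c≤n)
      (λ x a b p q → j x a b (fv-shift c P p) (fv-shift c Q q))
      (≤-trans (≤-reflexive (≡sym (deg-shift c m Δ P)))
               (≤-trans d (≤-reflexive (deg-shift c m Δ Q))))
good-unshift c m (lam n P) (lam g o) c≤n =
  lam (good-unshift (suc c) m P g (s≤s c≤n)) (occ-shift⁻ (suc c) P o (s≤s z≤n))

good-subst-arg : ∀ {Δ k} N B → Occ k B → IsGood Δ (subst k N B) → IsGood Δ N
good-subst-arg {Δ} {k} N (bv .k) here g = ≡subst (IsGood Δ) (subst-bv-here k N) g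
good-subst-arg N (app P Q) (appˡ o)  (app gP _ _ _) = good-subst-arg N P o gP
good-subst-arg N (app P Q) (appʳ o)  (app _ gQ _ _) = good-subst-arg N Q o gQ
good-subst-arg N (lam m B) (under o) (lam g _) =
  good-unshift 0 m N (good-subst-arg (shift 0 N) B o g) z≤n

good-subst-body : ∀ {Δ} k N B → IsTerm Δ B → k < length Δ → deg (delete k Δ) N ≡ nth Δ k →
                  IsGood (delete k Δ) (subst k N B) → IsGood Δ B
good-subst-body k N (fv x n) _ _ _ _ = fv x n
good-subst-body k N (bv i) (bv i<n) _ _ _ = bv i<n
good-subst-body {Δ} k N (app P Q) (app tP tQ j) k<n dN (app gP gQ _ d) =
  app (good-subst-body k N P tP k<n dN gP) (good-subst-body k N Q tQ k<n dN gQ) j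
      (≤-trans (≤-reflexive (≡sym (deg-subst k Δ N P dN)))
               (≤-trans d (≤-reflexive (deg-subst k Δ N Q dN))))
good-subst-body {Δ} k N (lam m B) (lam t o) k<n dN (lam g _) =
  lam (good-subst-body (suc k) (shift 0 N) B t (s≤s k<n)
         (≡trans (deg-shift 0 m (delete k Δ) N) dN) g) o

good-step⁻ : ∀ {Δ M N} → IsTerm Δ M → Δ ⊢ M ▷β N → IsGood Δ N → IsGood Δ M
good-step⁻ {Δ} (app (lam {n = n} tB o) _ j) (β {M = B} {N = N} dN) g =
  app (lam (good-subst-body 0 N B tB (s≤s z≤n) dN g) o) (good-subst-arg N B o g) j
      (≤-trans (deg-occ (n ∷ Δ) o) (≤-reflexive (≡sym dN)))
good-step⁻ (app tM _ j) (appˡ s) (app gM gN _ d) =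
  app (good-step⁻ tM s gM) gN j (≤-trans (≤-reflexive (≡sym (deg-step tM s))) d)
good-step⁻ (app _ tN j) (appʳ s) (app gM gN _ d) =
  app gM (good-step⁻ tN s gN) j (≤-trans d (≤-reflexive (deg-step tN s)))
good-step⁻ (lam t o) (lam s) (lam g _) = lam (good-step⁻ t s g) o

▷β*-trans : ∀ {M N P} → M ▷β* N → N ▷β* P → M ▷β* P
▷β*-trans refl       r′ = r′
▷β*-trans (step s r) r′ = step s (▷β*-trans r r′)

▷β*-appˡ : ∀ {M M′ N} → M ▷β* M′ → app M N ▷β* app M′ N
▷β*-appˡ refl       = refl
▷β*-appˡ (step s r) = step (appˡ s) (▷β*-appˡ r)

good-▷β*⁻ : ∀ {M N} → 𝓜 M → M ▷β* N → IsGood [] N → IsGood [] M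
good-▷β*⁻ t refl       g = g
good-▷β*⁻ t (step s r) g = good-step⁻ t s (good-▷β*⁻ (term-step t s) r g)

deg-▷β* : ∀ {M N} → 𝓜 M → M ▷β* N → deg [] N ≡ deg [] M
deg-▷β* t refl       = refl
deg-▷β* t (step s r) = ≡trans (deg-▷β* (term-step t s) r) (deg-step t s)

𝕄⁰-▷β*⁻ : ∀ {M N} → 𝓜 M → M ▷β* N → 𝕄⁰ N → 𝕄⁰ M
𝕄⁰-▷β*⁻ t r (g , d) = good-▷β*⁻ t r g , ≡trans (≡sym (deg-▷β* t r)) d

fv-▷β*⁻ : ∀ {M N x n} → M ▷β* N → FreeIn x n N → FreeIn x n M
fv-▷β*⁻ refl       p = p
fv-▷β*⁻ (step s r) p = fv-step⁻ s (fv-▷β*⁻ r p)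

fv-▷β* : ∀ {M N x n} → 𝓜 M → M ▷β* N → FreeIn x n M → FreeIn x n N
fv-▷β* t refl       p = p
fv-▷β* t (step s r) p = fv-▷β* (term-step t s) r (fv-step t s p)

==ᴺ-true : ∀ x y → (x ==ᴺ y) ≡ true → x ≡ y
==ᴺ-true (v₁ i) (v₁ j) e = cong v₁ (≡ᵇ-true i j e)
==ᴺ-true (v₂ i) (v₂ j) e = cong v₂ (≡ᵇ-true i j e)

==ᴺ-refl : ∀ x → (x ==ᴺ x) ≡ true
==ᴺ-refl (v₁ i) = ≡ᵇ-refl i
==ᴺ-refl (v₂ i) = ≡ᵇ-refl i

sameVar-true : ∀ x n y m → sameVar x n y m ≡ true → x ≡ y × n ≡ m
sameVar-true x n y m e with x ==ᴺ y in ex | n ≡ᵇ m in en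
sameVar-true x n y m refl | true | true = ==ᴺ-true x y ex , ≡ᵇ-true n m en

sameVar-refl : ∀ x n → sameVar x n x n ≡ true
sameVar-refl x n rewrite ==ᴺ-refl x | ≡ᵇ-refl n = refl

module _ {x : Name} {n : ℕ} where
  close-fresh : ∀ k P → ¬ FreeIn x n P → close x n k P ≡ P
  close-fresh k (fv y m) x∉P with sameVar x n y m in e
  ... | true with sameVar-true x n y m e
  ...   | refl , refl = ⊥-elim (x∉P here)
  close-fresh k (fv y m) x∉P | false = refl
  close-fresh k (bv i) _ = refl
  close-fresh k (app P Q) x∉PQ =
    cong₂ app (close-fresh k P (λ p → x∉PQ (appˡ p))) (close-fresh k Q (λ p → x∉PQ (appʳ p)))
  close-fresh k (lam m P) x∉P = cong (lam m) (close-fresh (suc k) P (λ p → x∉P (under p)))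

  close-to-bv : ∀ k P → close x n k P ≡ bv k → P ≡ fv x n ⊎ P ≡ bv k
  close-to-bv k (fv y m) e with sameVar x n y m in s
  ... | true with sameVar-true x n y m s
  ...   | refl , refl = inj₁ refl
  close-to-bv k (fv y m) () | false
  close-to-bv k (bv i) e = inj₂ e

  close-shift : ∀ c k P → c ≤ k → close x n (suc k) (shift c P) ≡ shift c (close x n k P)
  close-shift c k (fv y m) c≤k with sameVar x n y m
  ... | true  = ≡sym (shift-bv-above c≤k)
  ... | false = refl
  close-shift c k (bv i) _ with i <ᵇ c
  ... | true  = refl
  ... | false = refl
  close-shift c k (app P Q) c≤k = cong₂ app (close-shift c k P c≤k) (close-shift c k Q c≤k)
  close-shift c k (lam m P) c≤k = cong (lam m) (close-shift (suc c) (suc k) P (s≤s c≤k))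

  close-subst : ∀ j k N B → j ≤ k →
    close x n k (subst j N B) ≡ subst j (close x n k N) (close x n (suc k) B)
  close-subst j k N (fv y m) j≤k with sameVar x n y m
  ... | true  = ≡sym (subst-bv-above (close x n k N) (s≤s j≤k))
  ... | false = refl
  close-subst j k N (bv i) _ with <-cmp i j
  ... | tri< i<j _ _ rewrite subst-bv-below N i<j | subst-bv-below (close x n k N) i<j = refl
  ... | tri≈ _ refl _ rewrite subst-bv-here i N | subst-bv-here i (close x n k N) = refl
  ... | tri> _ _ j<i rewrite subst-bv-above N j<i | subst-bv-above (close x n k N) j<i = refl
  close-subst j k N (app P Q) j≤k = cong₂ app (close-subst j k N P j≤k) (close-subst j k N Q j≤k)
  close-subst j k N (lam m B) j≤k =
    cong (lam m) (≡trans (close-subst (suc j) (suc k) (shift 0 N) B (s≤s j≤k))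
                         (cong (λ Z → subst (suc j) Z (close x n (suc (suc k)) B))
                               (close-shift 0 k N z≤n)))

  deg-close : ∀ Δ k P → nth Δ k ≡ n → deg Δ (close x n k P) ≡ deg Δ P
  deg-close Δ k (fv y m) dk with sameVar x n y m in e
  ... | true  = ≡trans dk (proj₂ (sameVar-true x n y m e))
  ... | false = refl
  deg-close Δ k (bv i) _ = refl
  deg-close Δ k (app P Q) dk = cong₂ _⊓_ (deg-close Δ k P dk) (deg-close Δ k Q dk)
  deg-close Δ k (lam m P) dk = deg-close (m ∷ Δ) (suc k) P dk

  close-step : ∀ {Δ P P′} k → Δ ⊢ P ▷β P′ → nth Δ k ≡ n →
               Δ ⊢ close x n k P ▷β close x n k P′
  close-step {Δ} k (β {M = B} {N = N} dN) dk
    rewrite close-subst 0 k N B z≤n = β (≡trans (deg-close Δ k N dk) dN)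
  close-step k (appˡ s) dk = appˡ (close-step k s dk)
  close-step k (appʳ s) dk = appʳ (close-step k s dk)
  close-step k (lam s)  dk = lam (close-step (suc k) s dk)

step-≗ⁿ : ∀ {Δ Δ′ P P′} → Δ ≗ⁿ Δ′ → Δ ⊢ P ▷β P′ → Δ′ ⊢ P ▷β P′
step-≗ⁿ h (β {N = N} dN) = β (≡trans (≡sym (deg-≗ⁿ h N)) dN)
step-≗ⁿ h (appˡ s)       = appˡ (step-≗ⁿ h s)
step-≗ⁿ h (appʳ s)       = appʳ (step-≗ⁿ h s)
step-≗ⁿ h (lam {n = n} s) = lam (step-≗ⁿ (≗ⁿ-extend n h) s)

_⊢ⁿ_▷β*_ : List ℕ → Tm → Tm → Set
Δ ⊢ⁿ M ▷β* N = Star (Δ ⊢_▷β_) M N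

▷β*-lam : ∀ {n B B′} → (n ∷ []) ⊢ⁿ B ▷β* B′ → lam n B ▷β* lam n B′
▷β*-lam ε       = refl
▷β*-lam (s ◅ r) = step (lam s) (▷β*-lam r)

-- the top-level context gives every position the default degree 0, as does
-- the context of a single λ⁰ binder
[]≗ⁿ[0] : [] ≗ⁿ (0 ∷ [])
[]≗ⁿ[0] zero    = refl
[]≗ⁿ[0] (suc i) = refl

close-▷β* : ∀ {x M M′} → M ▷β* M′ → (0 ∷ []) ⊢ⁿ close x 0 0 M ▷β* close x 0 0 M′
close-▷β* refl       = ε
close-▷β* (step s r) = step-≗ⁿ []≗ⁿ[0] (close-step 0 s refl) ◅ close-▷β* r

subst-bv-id : ∀ {Δ} k B → IsTerm Δ B → length Δ ≤ suc k → subst k (bv k) B ≡ B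
subst-bv-id k (fv y m) _ _ = refl
subst-bv-id k (bv i) (bv i<n) n≤k+1 with <-cmp i k
... | tri< i<k _ _ = subst-bv-below (bv k) i<k
... | tri≈ _ refl _ = subst-bv-here i (bv i)
... | tri> _ _ k<i = ⊥-elim (<-irrefl refl (≤-trans (s≤s k<i) (≤-trans i<n n≤k+1)))
subst-bv-id k (app P Q) (app tP tQ _) n≤k+1 =
  cong₂ app (subst-bv-id k P tP n≤k+1) (subst-bv-id k Q tQ n≤k+1)
subst-bv-id k (lam m B) (lam t _) n≤k+1 rewrite shift-bv-above {k} {0} z≤n =
  cong (lam m) (subst-bv-id (suc k) B t (s≤s n≤k+1))

-- the probe variable, from 𝒱₂ so that it is never the head of a 𝒱₁-neutral
y₀ : Tm
y₀ = fv (v₂ 0) 0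

-- a closed term that maps the probe to itself reduces to the identity:
-- reduce the head to λ⁰.B, fire the redex, and abstract y₀ again
probe-identity : ∀ P → 𝓜 P → Closed P → app P y₀ ▷β* y₀ → P ▷β* idTm
probe-identity (lam .0 B) (lam tB _) cP (step (β refl) r) =
  ▷β*-lam (≡subst (λ X → (0 ∷ []) ⊢ⁿ X ▷β* bv 0) closed-back (close-▷β* {x = v₂ 0} r))
  where
  closed-back : close (v₂ 0) 0 0 (subst 0 y₀ B) ≡ B
  closed-back = ≡trans (close-subst 0 0 y₀ B z≤n)
                (≡trans (cong (subst 0 (bv 0)) (close-fresh 1 B (λ p → cP (v₂ 0) 0 (under p))))
                        (subst-bv-id 0 B tB ≤-refl))
probe-identity P tP cP (step (appˡ s) r) =
  step s (probe-identity _ (term-step tP s) (λ x n p → cP x n (fv-step⁻ s p)) r)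
probe-identity P tP cP (step (appʳ ()) r)

spine-deg : ∀ {x M} → Spine x M → deg [] M ≡ 0
spine-deg head = refl
spine-deg (app {N = N} sp) rewrite spine-deg sp = refl

spine-head-free : ∀ {x M} → Spine x M → FreeIn x 0 M
spine-head-free head     = here
spine-head-free (app sp) = appˡ (spine-head-free sp)

NeutralOrProbe : Pred
NeutralOrProbe N = Σ Tm λ Q → N ▷β* Q × ((Σ ℕ λ k → 𝓝⁰ (v₁ k) Q) ⊎ Q ≡ y₀)

𝓘₀ : Interpretation
𝓘₀ = record
  { I    = λ _ N → 𝕄⁰ N × NeutralOrProbe N
  ; sat  = λ _ M N tM r (mN , (Q , r′ , q)) → 𝕄⁰-▷β*⁻ tM r mN , (Q , ▷β*-trans r r′ , q)
  ; neut = λ _ k M nM → (proj₂ nM , spine-deg (proj₁ nM)) , (M , refl , inj₁ (k , nM))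
  ; inM  = λ _ M → proj₁
  }

probe∈𝓘₀ : ∀ c → Interpretation.I 𝓘₀ c y₀
probe∈𝓘₀ c = (fv (v₂ 0) 0 , refl) , (y₀ , refl , inj₂ refl)

closed-probe-not-neutral : ∀ {M Q k} → Closed M → app M y₀ ▷β* Q → Spine (v₁ k) Q → ⊥
closed-probe-not-neutral cM r sp with fv-▷β*⁻ r (spine-head-free sp)
... | appˡ p = cM _ _ p
... | appʳ ()

part1⇒ : ∀ a b M → ⟪ at a ∩ at b ⇒ at a ⟫ M → 𝕄⁰ M × M ▷β* idTm
part1⇒ a b M (tM , cM , inAll)
  with proj₂ (inAll 𝓘₀) y₀ (probe∈𝓘₀ a , probe∈𝓘₀ b) (λ x m _ p _ → ⊥-elim (cM x m p))
... | (app gM _ _ dM≤0 , _) , (_ , r , inj₂ refl) = (gM , n≤0⇒n≡0 dM≤0) , probe-identity M tM cM r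
... | _ , (_ , r , inj₁ (_ , sp , _)) = ⊥-elim (closed-probe-not-neutral cM r sp)

part1⇐ : ∀ a b M → 𝕄⁰ M × M ▷β* idTm → ⟪ at a ∩ at b ⇒ at a ⟫ M
part1⇐ a b M (mM , r) = tM , closed , λ 𝓘 → tM , λ N N∈ j → apply 𝓘 N N∈ j
  where
  tM : 𝓜 M
  tM = good⇒term (proj₁ mM)

  -- M has the free variables of λy⁰.y⁰, i.e. none
  closed : Closed M
  closed x n p with fv-▷β* tM r p
  ... | under ()

  -- M N ▷β* (λy⁰.y⁰) N ▷β N, and 𝓘(a) is saturated
  apply : (𝓘 : Interpretation) → ∀ N → ⟦ 𝓘 ∣ at a ∩ at b ⟧ N → Joinable M N →
          ⟦ 𝓘 ∣ at a ⟧ (app M N)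
  apply 𝓘 N (N∈a , _) j =
    Interpretation.sat 𝓘 a (app M N) N (app tM (good⇒term (proj₁ mN)) j)
      (▷β*-trans (▷β*-appˡ r) (step (β (proj₂ mN)) refl)) N∈a
    where
    mN : 𝕄⁰ N
    mN = Interpretation.inM 𝓘 a N N∈a

hasAtom : ℕ → Ty → Bool
hasAtom b (at c)   = c ≡ᵇ b
hasAtom b (U ⇒ T)  = false
hasAtom b (U ∩ V)  = hasAtom b U ∨ hasAtom b V
hasAtom b (ex e U) = false

skewed : ℕ → Ty → Bool
skewed b (at c)   = false
skewed b (U ⇒ T)  = hasAtom b U xor hasAtom b T
skewed b (U ∩ V)  = skewed b U ∨ skewed b V
skewed b (ex e U) = false

hasAtom-≈ : ∀ b {U V} → U ≈ V → hasAtom b U ≡ hasAtom b V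
hasAtom-≈ b refl         = refl
hasAtom-≈ b (sym p)      = ≡sym (hasAtom-≈ b p)
hasAtom-≈ b (trans p q)  = ≡trans (hasAtom-≈ b p) (hasAtom-≈ b q)
hasAtom-≈ b (⇒-cong p q) = refl
hasAtom-≈ b (∩-cong p q) = cong₂ _∨_ (hasAtom-≈ b p) (hasAtom-≈ b q)
hasAtom-≈ b (ex-cong p)  = refl
hasAtom-≈ b (∩-comm {U} {V})          = ∨-comm (hasAtom b U) (hasAtom b V)
hasAtom-≈ b (∩-assoc {U} {V} {W})     = ∨-assoc (hasAtom b U) (hasAtom b V) (hasAtom b W)
hasAtom-≈ b (∩-idem {U})              = ∨-idem (hasAtom b U)
hasAtom-≈ b ex-distr     = refl

skewed-≈ : ∀ b {U V} → U ≈ V → skewed b U ≡ skewed b V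
skewed-≈ b refl         = refl
skewed-≈ b (sym p)      = ≡sym (skewed-≈ b p)
skewed-≈ b (trans p q)  = ≡trans (skewed-≈ b p) (skewed-≈ b q)
skewed-≈ b (⇒-cong p q) = cong₂ _xor_ (hasAtom-≈ b p) (hasAtom-≈ b q)
skewed-≈ b (∩-cong p q) = cong₂ _∨_ (skewed-≈ b p) (skewed-≈ b q)
skewed-≈ b (ex-cong p)  = refl
skewed-≈ b (∩-comm {U} {V})      = ∨-comm (skewed b U) (skewed b V)
skewed-≈ b (∩-assoc {U} {V} {W}) = ∨-assoc (skewed b U) (skewed b V) (skewed b W)
skewed-≈ b (∩-idem {U})          = ∨-idem (skewed b U)
skewed-≈ b ex-distr     = refl

⁺≢fv⁰ : ∀ M {x} → M ⁺ ≢ fv x 0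
⁺≢fv⁰ (fv y n)  ()
⁺≢fv⁰ (bv i)    ()
⁺≢fv⁰ (app M N) ()
⁺≢fv⁰ (lam n M) ()

⁺-bv : ∀ M {i} → M ⁺ ≡ bv i → M ≡ bv i
⁺-bv (bv j) e = e

⁺≢id : ∀ M → M ⁺ ≢ idTm
⁺≢id (fv y n)  ()
⁺≢id (bv j)    ()
⁺≢id (app M N) ()
⁺≢id (lam n M) ()

⊓ᴱ-both : ∀ Γ₁ Γ₂ y m {U V} → Γ₁ y m ≡ just U → Γ₂ y m ≡ just V →
          (Γ₁ ⊓ᴱ Γ₂) y m ≡ just (U ∩ V)
⊓ᴱ-both Γ₁ Γ₂ y m e₁ e₂ rewrite e₁ | e₂ = refl

≈ᴹ-just : ∀ {m m′ U} → m ≡ just U → m ≈ᴹ m′ → Σ Ty λ U′ → m′ ≡ just U′ × U ≈ U′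
≈ᴹ-just refl (just p) = _ , refl , p

var-typing : ∀ b {t Γ T x} → t ∶⟨ Γ ⊢₁ T ⟩ → t ≡ fv x 0 →
             Σ Ty λ U → Γ x 0 ≡ just U × hasAtom b U ≡ hasAtom b T
var-typing b (ax {x = x} {T = T} _ _) refl rewrite sameVar-refl x 0 = T , refl , refl
var-typing b {x = x} (∩I {Γ₁ = Γ₁} {Γ₂ = Γ₂} d₁ d₂) e with var-typing b d₁ e | var-typing b d₂ e
... | U₁ , e₁ , h₁ | U₂ , e₂ , h₂ = U₁ ∩ U₂ , ⊓ᴱ-both Γ₁ Γ₂ x 0 e₁ e₂ , cong₂ _∨_ h₁ h₂
var-typing b (exp {M = M} _ _) e = ⊥-elim (⁺≢fv⁰ M e)
var-typing b {x = x} (cls d Γ≈ U≈) e with var-typing b d e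
... | U , e₁ , h with ≈ᴹ-just e₁ (Γ≈ x 0)
...   | U′ , e′ , U≈U′ = U′ , e′ , ≡trans (≡sym (hasAtom-≈ b U≈U′)) (≡trans h (hasAtom-≈ b U≈))

bv-untypable : ∀ {t Γ T i} → t ∶⟨ Γ ⊢₁ T ⟩ → t ≢ bv i
bv-untypable (∩I d _)          e = bv-untypable d e
bv-untypable (exp {M = M} _ d) e = bv-untypable d (⁺-bv M e)
bv-untypable (cls d _ _)       e = bv-untypable d e

lam-injective : ∀ {n m A B} → Tm.lam n A ≡ Tm.lam m B → n ≡ m × A ≡ B
lam-injective refl = refl , refl

just-injective : ∀ {A : Set} {u v : A} → Maybe.just u ≡ just v → u ≡ v
just-injective refl = refl

xor-self : ∀ {p q} → p ≡ q → (p xor q) ≡ false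
xor-self {false} refl = refl
xor-self {true}  refl = refl

id-typing-balanced : ∀ b {t Γ V} → t ∶⟨ Γ ⊢₁ V ⟩ → t ≡ idTm → skewed b V ≡ false
id-typing-balanced b (∩I d₁ d₂) e
  rewrite id-typing-balanced b d₁ e | id-typing-balanced b d₂ e = refl
id-typing-balanced b (exp {M = M} _ _) e = ⊥-elim (⁺≢id M e)
id-typing-balanced b (cls d _ U≈) e = ≡trans (≡sym (skewed-≈ b U≈)) (id-typing-balanced b d e)
id-typing-balanced b (⇒I {M = M} {Γ = Γ} {x = x} {U = U} _ d) e with lam-injective e
... | refl , body with close-to-bv 0 M body
...   | inj₂ refl = ⊥-elim (bv-untypable d refl)
...   | inj₁ refl with var-typing b d refl
...     | U′ , declared , h =
  xor-self (≡trans (cong (hasAtom b) (just-injective (≡trans (≡sym self) declared))) h)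
  where
  self : extend Γ x 0 U x 0 ≡ just U
  self rewrite sameVar-refl x 0 = refl

part2 : ∀ a b → a ≢ b → ¬ (idTm ∶⟨ ∅ ⊢₁ at a ∩ at b ⇒ at a ⟩)
part2 a b a≢b d = true≢false (≡trans (≡sym goal-skewed) (id-typing-balanced b d refl))
  where
  goal-skewed : skewed b (at a ∩ at b ⇒ at a) ≡ true
  goal-skewed rewrite ≢⇒≡ᵇ-false a b a≢b | ≡ᵇ-refl b = refl

  true≢false : true ≢ false
  true≢false ()

part3 : ∀ a b → idTm ∶⟨ ∅ ⊢₂ at a ∩ at b ⇒ at a ⟩
part3 a b =
  ⇒I {M = fv x 0} {x = x} {n = 0} (u∩ (ut (at a)) (ut (at b))) (at a) refl
     (sub (ax {x = x} (at a) (at a))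
          (typ (refl (ut (at a)) refl)
               (pt {Γ = ∅} {y = x} {n = 0} refl (∩-lb (ut (at a)) (ut (at b)) (at b) refl))))
  where
  x : Name
  x = v₁ 0

lemma3 : (a b : ℕ) → a ≢ b →
    ((M : Tm) → (⟪ at a ∩ at b ⇒ at a ⟫ M → 𝕄⁰ M × M ▷β* idTm)
              × (𝕄⁰ M × M ▷β* idTm → ⟪ at a ∩ at b ⇒ at a ⟫ M))
    × ¬ (idTm ∶⟨ ∅ ⊢₁ at a ∩ at b ⇒ at a ⟩)
    × (idTm ∶⟨ ∅ ⊢₂ at a ∩ at b ⇒ at a ⟩)
lemma3 a b a≢b = (λ M → part1⇒ a b M , part1⇐ a b M) , part2 a b a≢b , part3 a b
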